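{- The construction $\mathsf{As}$, which sends a finite poset $\mathcal{Q}$ to the operad $\mathsf{As}(\mathcal{Q})$ and a morphism of posets $\phi:\mathcal{Q}_1\to\mathcal{Q}_2$ to the map $\mathsf{As}(\phi)$ defined on generators by $\mathsf{As}(\phi)(\star_x):=\star_{\phi(x)}$ for $x\in\mathcal{Q}_1$, is a functor from the category of finite posets to the category of binary and quadratic nonsymmetric operads. (In particular, for every morphism of posets $\phi$, $\mathsf{As}(\phi)$ extends uniquely to an operad morphism $\mathsf{As}(\mathcal{Q}_1)\to\mathsf{As}(\mathcal{Q}_2)$.)
   Context: All operads are nonsymmetric operads in vector spaces over a field $\mathbb{K}$ of characteristic zero. A morphism of posets $\phi:\mathcal{Q}_1\to\mathcal{Q}_2$ is a map with $x\preccurlyeq y\Rightarrow \phi(x)\preccurlyeq\phi(y)$. For a finite poset $(\mathcal{Q},\preccurlyeq_\mathcal{Q})$ and comparable $a,b\in\mathcal{Q}$, write $a\uparrow_\mathcal{Q} b:=\min(a,b)$. The $\mathcal{Q}$-associative operad $\mathsf{As}(\mathcal{Q})$ is the operad $\mathrm{Free}(\mathfrak{G})/\langle\mathfrak{R}\rangle$, where $\mathfrak{G}=\{\star_a : a\in\mathcal{Q}\}$ is a set of generators of arity $2$ (so $\mathrm{Free}(\mathfrak{G})$ is spanned by binary syntax trees with internal nodes labeled by the $\star_a$), and $\mathfrak{R}$ is the subspace spanned by the elements $\star_a\circ_1\star_b-\star_{a\uparrow_\mathcal{Q} b}\circ_2\star_{a\uparrow_\mathcal{Q} b}$ and $\star_{a\uparrow_\mathcal{Q}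 b}\circ_1\star_{a\uparrow_\mathcal{Q} b}-\star_a\circ_2\star_b$ for all $a,b\in\mathcal{Q}$ with $a\preccurlyeq_\mathcal{Q} b$ or $b\preccurlyeq_\mathcal{Q} a$ (including $a=b$). Here $\star_a$ also denotes its image in $\mathsf{As}(\mathcal{Q})$. -}

module Defs where

open import Level using (Level; 0ℓ)
open import Data.Nat using (ℕ; zero; suc; _+_; _∸_; pred; _<ᵇ_)
open import Data.Fin using (Fin; toℕ)
open import Data.Fin.Properties using () renaming (_≟_ to _≟F_)
open import Data.Bool using (if_then_else_)
open import Data.List using (List; []; _∷_; _++_; map; concatMap; [_])
open import Data.List.Relation.Unary.All using (All)
open import Data.Product using (Σ; _×_; _,_; proj₁; proj₂; ∃)
open import Data.Sum using (_⊎_; inj₁; inj₂)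
open import Relation.Nullary using (¬_; Dec; yes; no)
open import Relation.Binary.PropositionalEquality using (_≡_; refl; cong; cong₂)
open import Relation.Binary.Structures using (IsPartialOrder)
open import Algebra.Bundles using (CommutativeRing)
open import Function using (_∘_; id)

record FinPoset : Set₁ where
  field
    size           : ℕ
    _≼_            : Fin size → Fin size → Set
    isPartialOrder : IsPartialOrder _≡_ _≼_

open FinPoset public

Elt : FinPoset → Set
Elt Q = Fin (size Q)

record PosetMorphism (Q₁ Q₂ : FinPoset) : Set where
  field
    fun  : Elt Q₁ → Elt Q₂
    mono : ∀ {x y} → _≼_ Q₁ x y → _≼_ Q₂ (fun x) (fun y)

open PosetMorphism public

idMorphism : (Q : FinPoset) → PosetMorphism Q Q
idMorphism Q = record { fun = id ; mono = id }

_∘P_ : {Q₁ Q₂ Q₃ : FinPoset} → PosetMorphism Q₂ Q₃ → PosetMorphism Q₁ Q₂ → PosetMorphism Q₁ Q₃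
ψ ∘P φ = record { fun = fun ψ ∘ fun φ ; mono = mono ψ ∘ mono φ }

Comparable : (Q : FinPoset) → Elt Q → Elt Q → Set
Comparable Q a b = _≼_ Q a b ⊎ _≼_ Q b a

-- a ↑ b := min(a , b), for comparable a, b (the witness says which is smaller;
-- if both hold then a ≡ b by antisymmetry, so this is well defined).
up : (Q : FinPoset) (a b : Elt Q) → Comparable Q a b → Elt Q
up Q a b (inj₁ _) = a
up Q a b (inj₂ _) = b

-- Binary syntax trees (basis of the free operad on binary generators)

data Tree (A : Set) : Set where
  leaf : Tree A
  node : A → Tree A → Tree A → Tree A

arity : {A : Set} → Tree A → ℕ
arity leaf = 1
arity (node _ l r) = arity l + arity r

-- graft t i s  =  t ∘_{i+1} s  (leaves numbered from 0, left to right);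
-- only ever used with i < arity t.
graft : {A : Set} → Tree A → ℕ → Tree A → Tree A
graft leaf zero s = s
graft leaf (suc i) s = leaf
graft (node a l r) i s =
  if i <ᵇ arity l then node a (graft l i s) r
                  else node a l (graft r (i ∸ arity l) s)

relabel : {A B : Set} → (A → B) → Tree A → Tree B
relabel f leaf = leaf
relabel f (node a l r) = node (f a) (relabel f l) (relabel f r)

gen : {A : Set} → A → Tree A
gen a = node a leaf leaf

_∘₁_ : {A : Set} → A → A → Tree A
a ∘₁ b = node a (gen b) leaf

_∘₂_ : {A : Set} → A → A → Tree A
a ∘₂ b = node a leaf (gen b)

_≟T_ : {n : ℕ} (s t : Tree (Fin n)) → Dec (s ≡ t)
leaf ≟T leaf = yes refl
leaf ≟T node _ _ _ = no (λ ())
node _ _ _ ≟T leaf = no (λ ())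
node a l r ≟T node b l' r' with a ≟F b | l ≟T l' | r ≟T r'
... | yes refl | yes refl | yes refl = yes refl
... | no ¬p | _ | _ = no (λ { refl → ¬p refl })
... | yes _ | no ¬p | _ = no (λ { refl → ¬p refl })
... | yes _ | yes _ | no ¬p = no (λ { refl → ¬p refl })

module _ {c ℓ} (K : CommutativeRing c ℓ) where
  open CommutativeRing K renaming (_+_ to _+K_)

  record IsField : Set (c Level.⊔ ℓ) where
    field
      nontrivial : ¬ (1# ≈ 0#)
      inverse    : ∀ x → ¬ (x ≈ 0#) → ∃ λ y → (x * y) ≈ 1#

  natMul : ℕ → Carrier
  natMul zero = 0#
  natMul (suc n) = 1# +K natMul n

  CharZero : Set ℓ
  CharZero = ∀ n → ¬ (natMul (suc n) ≈ 0#)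

module Construction {c ℓ} (K : CommutativeRing c ℓ) where
  open CommutativeRing K renaming (_+_ to _+K_)

  -- Elements of Free(𝔊): finite formal K-linear combinations of trees.
  LC : Set → Set c
  LC A = List (Carrier × Tree A)

  Homog : {A : Set} → ℕ → LC A → Set c
  Homog n x = All (λ p → arity (proj₂ p) ≡ n) x

  _·_ : {A : Set} → Carrier → LC A → LC A
  k · x = map (λ p → (k * proj₁ p , proj₂ p)) x

  _⊖_ : {A : Set} → LC A → LC A → LC A
  x ⊖ y = x ++ ((- 1#) · y)

  -- partial composition x ∘_{i+1} y, extended bilinearly
  _∘⟨_⟩_ : {A : Set} → LC A → ℕ → LC A → LC A
  x ∘⟨ i ⟩ y = concatMap (λ p → map (λ q → (proj₁ p * proj₁ q , graft (proj₂ p) i (proj₂ q))) y) x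

  unitLC : {A : Set} → LC A
  unitLC = [ (1# , leaf) ]

  genLC : {A : Set} → A → LC A
  genLC a = [ (1# , gen a) ]

  relabelLC : {A B : Set} → (A → B) → LC A → LC B
  relabelLC f = map (λ p → (proj₁ p , relabel f (proj₂ p)))

  coeff : {n : ℕ} → LC (Fin n) → Tree (Fin n) → Carrier
  coeff [] t = 0#
  coeff ((k , s) ∷ x) t with s ≟T t
  ... | yes _ = k +K coeff x t
  ... | no _  = coeff x t

  _≈LC_ : {n : ℕ} → LC (Fin n) → LC (Fin n) → Set ℓ
  x ≈LC y = ∀ t → coeff x t ≈ coeff y t

  module _ (Q : FinPoset) where
    T = Tree (Elt Q)

    -- The operad ideal ⟨ℜ⟩ of Free(𝔊), arity by arity: the smallest family of
    -- subspaces containing ℜ and closed under partial compositions with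
    -- arbitrary elements (on either side).
    data Ideal : ℕ → LC (Elt Q) → Set (c Level.⊔ ℓ) where
      rel₁  : (a b : Elt Q) (p : Comparable Q a b) →
              Ideal 3 ([ (1# , a ∘₁ b) ] ⊖ [ (1# , up Q a b p ∘₂ up Q a b p) ])
      rel₂  : (a b : Elt Q) (p : Comparable Q a b) →
              Ideal 3 ([ (1# , up Q a b p ∘₁ up Q a b p) ] ⊖ [ (1# , a ∘₂ b) ])
      nil   : ∀ {n} → Ideal n []
      add   : ∀ {n x y} → Ideal n x → Ideal n y → Ideal n (x ++ y)
      scale : ∀ {n x} (k : Carrier) → Ideal n x → Ideal n (k · x)
      resp  : ∀ {n x y} → x ≈LC y → Homog n y → Ideal n x → Ideal n y
      compL : ∀ {m k x y} → Ideal m x → Homog k y → (i : Fin m) →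
              Ideal (pred m + k) (x ∘⟨ toℕ i ⟩ y)
      compR : ∀ {m k x y} → Homog m y → (i : Fin m) → Ideal k x →
              Ideal (pred m + k) (y ∘⟨ toℕ i ⟩ x)

    -- equality in As(Q)(n) = Free(𝔊)(n) / ⟨ℜ⟩(n)
    _~⟨_⟩_ : LC (Elt Q) → ℕ → LC (Elt Q) → Set (c Level.⊔ ℓ)
    x ~⟨ n ⟩ y = Ideal n (x ⊖ y)

  As₁ : {Q₁ Q₂ : FinPoset} → PosetMorphism Q₁ Q₂ → LC (Elt Q₁) → LC (Elt Q₂)
  As₁ φ = relabelLC (fun φ)

  -- An operad morphism As(Q₁) → As(Q₂), given on representatives.
  record IsOperadMorphism (Q₁ Q₂ : FinPoset) (F : LC (Elt Q₁) → LC (Elt Q₂)) : Set (c Level.⊔ ℓ) where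
    field
      homog    : ∀ {n x} → Homog n x → Homog n (F x)
      wellDef  : ∀ {n x y} → Homog n x → Homog n y →
                 _~⟨_⟩_ Q₁ x n y → _~⟨_⟩_ Q₂ (F x) n (F y)
      additive : ∀ {n x y} → Homog n x → Homog n y →
                 _~⟨_⟩_ Q₂ (F (x ++ y)) n (F x ++ F y)
      scalar   : ∀ {n x} (k : Carrier) → Homog n x →
                 _~⟨_⟩_ Q₂ (F (k · x)) n (k · F x)
      unit     : _~⟨_⟩_ Q₂ (F unitLC) 1 unitLC
      comp     : ∀ {m k x y} → Homog m x → Homog k y → (i : Fin m) →
                 _~⟨_⟩_ Q₂ (F (x ∘⟨ toℕ i ⟩ y)) (pred m + k) (F x ∘⟨ toℕ i ⟩ F y)

-- Relabelling commutes with
-- grafting, sums and scalars, and it sends each defining relation of As(Q₁) to one of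
-- As(Q₂): a comparable pair a, b goes to the comparable pair φ a, φ b, and a ↑ b to
-- φ a ↑ φ b. The one non-formal point is that relabelling respects equality of
-- coefficients; this holds because the coefficient of t in a relabelled combination is
-- a linear functional of the original one (evaluation at the indicator of the fibre over
-- t), and linear functionals only see coefficients. Functoriality is relabel id = id and
-- relabel (g ∘ f) = relabel g ∘ relabel f. Uniqueness: every tree is an iterated
-- composite of generators, node a l r = (⋆a ∘₂ r) ∘₁ l, so an operad morphism is
-- determined by its values on the generators.

module Submission where

open import Defs
open import Level using (Level; _⊔_)
open import Data.Nat using (ℕ; zero; suc; pred; _+_; _∸_; _<ᵇ_; _<_; _≤_; s≤s; z≤n)
import Data.Nat.Properties as ℕₚ
open import Data.Fin using (Fin; toℕ) renaming (zero to fzero; suc to fsuc)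
open import Data.Fin.Properties using (toℕ<n)
open import Data.Bool using (true; false; T; if_then_else_)
open import Data.List using ([]; _∷_; _++_; map; [_]; length)
open import Data.List.Properties using (map-++; concatMap-++)
open import Data.List.Relation.Unary.All as All using ([]; _∷_)
open import Data.List.Relation.Unary.All.Properties using (++⁺; ++⁻; map⁺; map⁻)
open import Data.List.Relation.Binary.Pointwise as Pointwise using (Pointwise; []; _∷_)
open import Data.Product using (_×_; _,_; proj₁; proj₂)
open import Data.Sum using (inj₁; inj₂)
open import Relation.Nullary using (yes; no; does; contradiction)
open import Relation.Binary.PropositionalEquality
  using (_≡_; _≢_; refl; sym; trans; cong; cong₂; subst; module ≡-Reasoning)
open import Function using (_∘_; id)
open import Algebra.Bundles using (CommutativeRing)
open import Algebra.Properties.CommutativeSemigroup ℕₚ.+-commutativeSemigroup using (xy∙z≈xz∙y)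

arity-relabel : {A B : Set} (f : A → B) (t : Tree A) → arity (relabel f t) ≡ arity t
arity-relabel f leaf = refl
arity-relabel f (node a l r) = cong₂ _+_ (arity-relabel f l) (arity-relabel f r)

relabel-graft : {A B : Set} (f : A → B) (s : Tree A) (i : ℕ) (t : Tree A) →
  relabel f (graft s i t) ≡ graft (relabel f s) i (relabel f t)
relabel-graft f leaf zero t = refl
relabel-graft f leaf (suc i) t = refl
relabel-graft f (node a l r) i t rewrite arity-relabel f l with i <ᵇ arity l
... | true  = cong (λ l′ → node (f a) l′ (relabel f r)) (relabel-graft f l i t)
... | false = cong (node (f a) (relabel f l)) (relabel-graft f r (i ∸ arity l) t)

relabel-id : {A : Set} (t : Tree A) → relabel id t ≡ t
relabel-id leaf = refl
relabel-id (node a l r) = cong₂ (node a) (relabel-id l) (relabel-id r)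

relabel-∘ : {A B C : Set} (g : B → C) (f : A → B) (t : Tree A) →
  relabel (g ∘ f) t ≡ relabel g (relabel f t)
relabel-∘ g f leaf = refl
relabel-∘ g f (node a l r) = cong₂ (node (g (f a))) (relabel-∘ g f l) (relabel-∘ g f r)

arity-graft : {A : Set} (s : Tree A) (i : ℕ) (t : Tree A) → i < arity s →
  suc (arity (graft s i t)) ≡ arity s + arity t
arity-graft leaf zero t _ = refl
arity-graft leaf (suc i) t (s≤s ())
arity-graft (node a l r) i t i<s with i <ᵇ arity l in i<ᵇl
... | true = begin
  suc (arity (graft l i t)) + arity r ≡⟨ cong (_+ arity r) (arity-graft l i t i<l) ⟩
  arity l + arity t + arity r         ≡⟨ xy∙z≈xz∙y (arity l) (arity t) (arity r) ⟩
  arity l + arity r + arity t         ∎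
  where
  open ≡-Reasoning
  i<l : i < arity l
  i<l = ℕₚ.<ᵇ⇒< i (arity l) (subst T (sym i<ᵇl) _)
... | false = begin
  suc (arity l + arity (graft r j t)) ≡⟨ sym (ℕₚ.+-suc (arity l) _) ⟩
  arity l + suc (arity (graft r j t)) ≡⟨ cong (arity l +_) (arity-graft r j t j<r) ⟩
  arity l + (arity r + arity t)       ≡⟨ sym (ℕₚ.+-assoc (arity l) (arity r) (arity t)) ⟩
  arity l + arity r + arity t         ∎
  where
  open ≡-Reasoning
  j : ℕ
  j = i ∸ arity l
  l≤i : arity l ≤ i
  l≤i = ℕₚ.≮⇒≥ (λ i<l → subst T i<ᵇl (ℕₚ.<⇒<ᵇ i<l))
  j<r : j < arity r
  j<r = subst (j <_) (ℕₚ.m+n∸m≡n (arity l) (arity r)) (ℕₚ.∸-monoˡ-< i<s l≤i)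

module LinearCombinations {c ℓ} (K : CommutativeRing c ℓ) where
  open CommutativeRing K
    using (Carrier; _≈_; 0#; 1#; _*_; -_; setoid; +-cong; *-cong; +-assoc; +-identityˡ; +-identityʳ;
           *-identityʳ; *-assoc; zeroˡ; zeroʳ; distribˡ; distribʳ; -‿inverseʳ; commutativeSemiring;
           ring; +-group; +-commutativeSemigroup; *-commutativeSemigroup)
    renaming (_+_ to _+K_; refl to ≈-refl; reflexive to ≈-reflexive; sym to ≈-sym; trans to ≈-trans)
  open Construction K
  open import Algebra.Properties.Ring ring using (-1*x≈-x)
  open import Algebra.Properties.Group +-group using (x∙y⁻¹≈ε⇒x≈y)
  open import Algebra.Properties.CommutativeSemigroup +-commutativeSemigroup
    using (interchange) renaming (x∙yz≈y∙xz to +-left-comm)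
  open import Algebra.Properties.CommutativeSemigroup *-commutativeSemigroup
    using () renaming (x∙yz≈y∙xz to *-left-comm)
  open import Algebra.Solver.Ring.NaturalCoefficients.Default commutativeSemiring
    using (solve; _:+_; _:*_; _:=_)
  open import Relation.Binary.Reasoning.Setoid setoid

  -1# : Carrier
  -1# = - 1#

  x-x≈0 : ∀ a → a +K -1# * a ≈ 0#
  x-x≈0 a = ≈-trans (+-cong ≈-refl (-1*x≈-x a)) (-‿inverseʳ a)

  x-y≈0⇒x≈y : ∀ {a b} → a +K -1# * b ≈ 0# → a ≈ b
  x-y≈0⇒x≈y {a} {b} a-b≈0 =
    x∙y⁻¹≈ε⇒x≈y a b (≈-trans (+-cong ≈-refl (≈-sym (-1*x≈-x b))) a-b≈0)

  1*1*1≈1 : (1# * 1#) * 1# ≈ 1#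
  1*1*1≈1 = ≈-trans (*-identityʳ _) (*-identityʳ _)

  module _ {n : ℕ} where

    coeff-∷-≢ : ∀ k {u t : Tree (Fin n)} z → u ≢ t → coeff ((k , u) ∷ z) t ≈ coeff z t
    coeff-∷-≢ k {u} {t} z u≢t with u ≟T t
    ... | yes u≡t = contradiction u≡t u≢t
    ... | no _    = ≈-refl

    coeff-++ : (x y : LC (Fin n)) (t : Tree (Fin n)) → coeff (x ++ y) t ≈ coeff x t +K coeff y t
    coeff-++ [] y t = ≈-sym (+-identityˡ _)
    coeff-++ ((k , u) ∷ x) y t with u ≟T t
    ... | yes _ = ≈-trans (+-cong ≈-refl (coeff-++ x y t)) (≈-sym (+-assoc _ _ _))
    ... | no _  = coeff-++ x y t

    coeff-· : (k : Carrier) (x : LC (Fin n)) (t : Tree (Fin n)) → coeff (k · x) t ≈ k * coeff x t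
    coeff-· k [] t = ≈-sym (zeroʳ k)
    coeff-· k ((a , u) ∷ x) t with u ≟T t
    ... | yes _ = ≈-trans (+-cong ≈-refl (coeff-· k x t)) (≈-sym (distribˡ k a _))
    ... | no _  = coeff-· k x t

    coeff-⊖ : (x y : LC (Fin n)) (t : Tree (Fin n)) → coeff (x ⊖ y) t ≈ coeff x t +K -1# * coeff y t
    coeff-⊖ x y t = ≈-trans (coeff-++ x (-1# · y) t) (+-cong ≈-refl (coeff-· -1# y t))

    ⊖-null : (x y : LC (Fin n)) → x ≈LC y → [] ≈LC (x ⊖ y)
    ⊖-null x y x≈y t =
      ≈-sym (≈-trans (coeff-⊖ x y t) (≈-trans (+-cong (x≈y t) ≈-refl) (x-x≈0 _)))

  infix 4 _≈ₜ_ _≋_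

  _≈ₜ_ : {A : Set} → Carrier × Tree A → Carrier × Tree A → Set ℓ
  (k , s) ≈ₜ (k′ , s′) = k ≈ k′ × s ≡ s′

  _≋_ : {A : Set} → LC A → LC A → Set (c ⊔ ℓ)
  _≋_ = Pointwise _≈ₜ_

  ≋-refl : {A : Set} {x : LC A} → x ≋ x
  ≋-refl = Pointwise.refl (≈-refl , refl)

  ≋⇒≈LC : ∀ {n} {x y : LC (Fin n)} → x ≋ y → x ≈LC y
  ≋⇒≈LC [] t = ≈-refl
  ≋⇒≈LC {x = (_ , u) ∷ _} ((k≈k′ , refl) ∷ x≋y) t with u ≟T t
  ... | yes _ = +-cong k≈k′ (≋⇒≈LC x≋y t)
  ... | no _  = ≋⇒≈LC x≋y t

  ·-++ : {A : Set} (k : Carrier) (x y : LC A) → k · (x ++ y) ≡ k · x ++ k · y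
  ·-++ k = map-++ _

  ·-·-comm : {A : Set} (k k′ : Carrier) (x : LC A) → k · (k′ · x) ≋ k′ · (k · x)
  ·-·-comm k k′ [] = []
  ·-·-comm k k′ ((a , s) ∷ x) = (*-left-comm k k′ a , refl) ∷ ·-·-comm k k′ x

  homog-· : {A : Set} {n : ℕ} (k : Carrier) {x : LC A} → Homog n x → Homog n (k · x)
  homog-· k = map⁺

  homog-⊖ : {A : Set} {n : ℕ} {x y : LC A} → Homog n x → Homog n y → Homog n (x ⊖ y)
  homog-⊖ hx hy = ++⁺ hx (homog-· -1# hy)

  homog-⊖⁻ : {A : Set} {n : ℕ} (x : LC A) {y : LC A} → Homog n (x ⊖ y) → Homog n x × Homog n y
  homog-⊖⁻ x h with ++⁻ x h
  ... | hx , hy = hx , map⁻ hy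

  _∘ₜ⟨_⟩_ : {A : Set} → Carrier × Tree A → ℕ → LC A → LC A
  (a , s) ∘ₜ⟨ i ⟩ y = map (λ q → (a * proj₁ q , graft s i (proj₂ q))) y

  homog-∘ : {A : Set} {m k : ℕ} {x y : LC A} → Homog m x → Homog k y → (i : Fin m) →
    Homog (pred m + k) (x ∘⟨ toℕ i ⟩ y)
  homog-∘ {m = suc m} [] hy i = []
  homog-∘ {m = suc m} {x = (a , s) ∷ x} (s≡1+m ∷ hx) hy i =
    ++⁺ (homog-∘ₜ hy) (homog-∘ hx hy i)
    where
    i<s : toℕ i < arity s
    i<s = subst (toℕ i <_) (sym s≡1+m) (toℕ<n i)

    homog-∘ₜ : ∀ {k y} → Homog k y → Homog (m + k) ((a , s) ∘ₜ⟨ toℕ i ⟩ y)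
    homog-∘ₜ [] = []
    homog-∘ₜ {y = (b , u) ∷ _} (refl ∷ hy) =
      ℕₚ.suc-injective (trans (arity-graft s (toℕ i) u i<s) (cong (_+ arity u) s≡1+m))
        ∷ homog-∘ₜ hy

  ∘-++ˡ : {A : Set} (x x′ y : LC A) (i : ℕ) →
    (x ++ x′) ∘⟨ i ⟩ y ≡ x ∘⟨ i ⟩ y ++ x′ ∘⟨ i ⟩ y
  ∘-++ˡ x x′ y i = concatMap-++ _ x x′

  ∘-·ˡ : {A : Set} (k : Carrier) (x y : LC A) (i : ℕ) →
    (k · x) ∘⟨ i ⟩ y ≋ k · (x ∘⟨ i ⟩ y)
  ∘-·ˡ k [] y i = []
  ∘-·ˡ k (p@(a , s) ∷ x) y i =
    subst ((k · (p ∷ x)) ∘⟨ i ⟩ y ≋_) (sym (·-++ k (p ∘ₜ⟨ i ⟩ y) (x ∘⟨ i ⟩ y)))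
          (Pointwise.++⁺ (assocₜ y) (∘-·ˡ k x y i))
    where
    assocₜ : ∀ y → (k * a , s) ∘ₜ⟨ i ⟩ y ≋ k · ((a , s) ∘ₜ⟨ i ⟩ y)
    assocₜ [] = []
    assocₜ ((b , _) ∷ y) = (*-assoc k a b , refl) ∷ assocₜ y

  ∘-·ʳ : {A : Set} (k : Carrier) (x y : LC A) (i : ℕ) →
    x ∘⟨ i ⟩ (k · y) ≋ k · (x ∘⟨ i ⟩ y)
  ∘-·ʳ k [] y i = []
  ∘-·ʳ k (p@(a , s) ∷ x) y i =
    subst ((p ∷ x) ∘⟨ i ⟩ (k · y) ≋_) (sym (·-++ k (p ∘ₜ⟨ i ⟩ y) (x ∘⟨ i ⟩ y)))
          (Pointwise.++⁺ (commₜ y) (∘-·ʳ k x y i))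
    where
    commₜ : ∀ y → (a , s) ∘ₜ⟨ i ⟩ (k · y) ≋ k · ((a , s) ∘ₜ⟨ i ⟩ y)
    commₜ [] = []
    commₜ ((b , _) ∷ y) = (*-left-comm a k b , refl) ∷ commₜ y

  coeff-∘-++ʳ : ∀ {n} (x y y′ : LC (Fin n)) (i : ℕ) (t : Tree (Fin n)) →
    coeff (x ∘⟨ i ⟩ (y ++ y′)) t ≈ coeff (x ∘⟨ i ⟩ y) t +K coeff (x ∘⟨ i ⟩ y′) t
  coeff-∘-++ʳ [] y y′ i t = ≈-sym (+-identityˡ _)
  coeff-∘-++ʳ {n} (p ∷ x) y y′ i t = begin
    κ (p ∘ₜ⟨ i ⟩ (y ++ y′) ++ x ∘⟨ i ⟩ (y ++ y′))
      ≈⟨ coeff-++ (p ∘ₜ⟨ i ⟩ (y ++ y′)) _ t ⟩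
    κ (p ∘ₜ⟨ i ⟩ (y ++ y′)) +K κ (x ∘⟨ i ⟩ (y ++ y′))
      ≈⟨ +-cong (≈-trans (≈-reflexive (cong κ (map-++ _ y y′))) (coeff-++ (p ∘ₜ⟨ i ⟩ y) _ t))
                (coeff-∘-++ʳ x y y′ i t) ⟩
    (κ (p ∘ₜ⟨ i ⟩ y) +K κ (p ∘ₜ⟨ i ⟩ y′)) +K (κ (x ∘⟨ i ⟩ y) +K κ (x ∘⟨ i ⟩ y′))
      ≈⟨ interchange _ _ _ _ ⟩
    (κ (p ∘ₜ⟨ i ⟩ y) +K κ (x ∘⟨ i ⟩ y)) +K (κ (p ∘ₜ⟨ i ⟩ y′) +K κ (x ∘⟨ i ⟩ y′))
      ≈⟨ ≈-sym (+-cong (coeff-++ (p ∘ₜ⟨ i ⟩ y) _ t) (coeff-++ (p ∘ₜ⟨ i ⟩ y′) _ t)) ⟩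
    κ (p ∘ₜ⟨ i ⟩ y ++ x ∘⟨ i ⟩ y) +K κ (p ∘ₜ⟨ i ⟩ y′ ++ x ∘⟨ i ⟩ y′) ∎
    where
    κ : LC (Fin n) → Carrier
    κ z = coeff z t

  eval : {A : Set} → (Tree A → Carrier) → LC A → Carrier
  eval g [] = 0#
  eval g ((k , s) ∷ z) = k * g s +K eval g z

  eval-++ : {A : Set} (g : Tree A → Carrier) (x y : LC A) → eval g (x ++ y) ≈ eval g x +K eval g y
  eval-++ g [] y = ≈-sym (+-identityˡ _)
  eval-++ g ((k , s) ∷ x) y = ≈-trans (+-cong ≈-refl (eval-++ g x y)) (≈-sym (+-assoc _ _ _))

  eval-· : {A : Set} (g : Tree A → Carrier) (k : Carrier) (x : LC A) → eval g (k · x) ≈ k * eval g x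
  eval-· g k [] = ≈-sym (zeroʳ k)
  eval-· g k ((a , s) ∷ x) = ≈-trans (+-cong (*-assoc _ _ _) (eval-· g k x)) (≈-sym (distribˡ _ _ _))

  module _ {n : ℕ} where

    remove : Tree (Fin n) → LC (Fin n) → LC (Fin n)
    remove s [] = []
    remove s ((k , u) ∷ z) with u ≟T s
    ... | yes _ = remove s z
    ... | no _  = (k , u) ∷ remove s z

    length-remove : ∀ s z → length (remove s z) ≤ length z
    length-remove s [] = z≤n
    length-remove s ((k , u) ∷ z) with u ≟T s
    ... | yes _ = ℕₚ.m≤n⇒m≤1+n (length-remove s z)
    ... | no _  = s≤s (length-remove s z)

    length-remove-head : ∀ k s z → length (remove s ((k , s) ∷ z)) ≤ length z
    length-remove-head k s z with s ≟T s
    ... | yes _  = length-remove s z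
    ... | no s≢s = contradiction refl s≢s

    coeff-remove-self : ∀ s z → coeff (remove s z) s ≈ 0#
    coeff-remove-self s [] = ≈-refl
    coeff-remove-self s ((k , u) ∷ z) with u ≟T s
    ... | yes _   = coeff-remove-self s z
    ... | no u≢s = ≈-trans (coeff-∷-≢ k (remove s z) u≢s) (coeff-remove-self s z)

    coeff-remove-other : ∀ {s t} z → s ≢ t → coeff (remove s z) t ≈ coeff z t
    coeff-remove-other [] s≢t = ≈-refl
    coeff-remove-other {s} {t} ((k , u) ∷ z) s≢t with u ≟T s
    ... | yes refl = ≈-trans (coeff-remove-other z s≢t) (≈-sym (coeff-∷-≢ k z s≢t))
    ... | no _ with u ≟T t
    ...   | yes _ = +-cong ≈-refl (coeff-remove-other z s≢t)
    ...   | no _  = coeff-remove-other z s≢t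

    eval-remove : ∀ g s z → eval g z ≈ coeff z s * g s +K eval g (remove s z)
    eval-remove g s [] = ≈-sym (≈-trans (+-identityʳ _) (zeroˡ _))
    eval-remove g s ((k , u) ∷ z) with u ≟T s
    ... | yes refl = begin
      k * g u +K eval g z                                ≈⟨ +-cong ≈-refl (eval-remove g u z) ⟩
      k * g u +K (coeff z u * g u +K eval g (remove u z)) ≈⟨ ≈-sym (+-assoc _ _ _) ⟩
      (k * g u +K coeff z u * g u) +K eval g (remove u z) ≈⟨ +-cong (≈-sym (distribʳ _ _ _)) ≈-refl ⟩
      (k +K coeff z u) * g u +K eval g (remove u z)       ∎
    ... | no _ = ≈-trans (+-cong ≈-refl (eval-remove g s z)) (+-left-comm _ _ _)

    eval-null : ∀ g z → [] ≈LC z → eval g z ≈ 0#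
    eval-null g z = go (length z) z ℕₚ.≤-refl
      where
      go : ∀ m z → length z ≤ m → [] ≈LC z → eval g z ≈ 0#
      go _ [] _ _ = ≈-refl
      go (suc m) z@((k , s) ∷ z′) (s≤s |z′|≤m) 0≈z = begin
        eval g z                                 ≈⟨ eval-remove g s z ⟩
        coeff z s * g s +K eval g (remove s z)   ≈⟨ +-cong (*-cong (≈-sym (0≈z s)) ≈-refl) rest≈0 ⟩
        0# * g s +K 0#                           ≈⟨ ≈-trans (+-identityʳ _) (zeroˡ _) ⟩
        0#                                       ∎
        where
        rest-null : [] ≈LC remove s z
        rest-null t with s ≟T t
        ... | yes refl = ≈-sym (coeff-remove-self s z)
        ... | no s≢t  = ≈-trans (0≈z t) (≈-sym (coeff-remove-other z s≢t))
        rest≈0 : eval g (remove s z) ≈ 0#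
        rest≈0 = go m (remove s z) (ℕₚ.≤-trans (length-remove-head k s z′) |z′|≤m) rest-null

    eval-cong : ∀ g x y → x ≈LC y → eval g x ≈ eval g y
    eval-cong g x y x≈y = x-y≈0⇒x≈y (begin
      eval g x +K -1# * eval g y           ≈⟨ ≈-sym (+-cong ≈-refl (eval-· g -1# y)) ⟩
      eval g x +K eval g (-1# · y)         ≈⟨ ≈-sym (eval-++ g x (-1# · y)) ⟩
      eval g (x ⊖ y)                       ≈⟨ eval-null g (x ⊖ y) (⊖-null x y x≈y) ⟩
      0#                                   ∎)

  fibreIndicator : ∀ {a b} → (Fin a → Fin b) → Tree (Fin b) → Tree (Fin a) → Carrier
  fibreIndicator f t u = if does (relabel f u ≟T t) then 1# else 0#

  coeff-relabelLC : ∀ {a b} (f : Fin a → Fin b) z t →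
    coeff (relabelLC f z) t ≈ eval (fibreIndicator f t) z
  coeff-relabelLC f [] t = ≈-refl
  coeff-relabelLC f ((k , u) ∷ z) t with relabel f u ≟T t
  ... | yes _ = +-cong (≈-sym (*-identityʳ k)) (coeff-relabelLC f z t)
  ... | no _  =
    ≈-trans (coeff-relabelLC f z t) (≈-sym (≈-trans (+-cong (zeroʳ k) ≈-refl) (+-identityˡ _)))

  relabelLC-cong : ∀ {a b} (f : Fin a → Fin b) x y → x ≈LC y → relabelLC f x ≈LC relabelLC f y
  relabelLC-cong f x y x≈y t =
    ≈-trans (coeff-relabelLC f x t)
            (≈-trans (eval-cong (fibreIndicator f t) x y x≈y) (≈-sym (coeff-relabelLC f y t)))

  module _ {A B : Set} (f : A → B) where

    homog-relabelLC : ∀ {n} {x : LC A} → Homog n x → Homog n (relabelLC f x)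
    homog-relabelLC = map⁺ ∘ All.map (λ {(_ , u)} → trans (arity-relabel f u))

    relabelLC-++ : (x y : LC A) → relabelLC f (x ++ y) ≡ relabelLC f x ++ relabelLC f y
    relabelLC-++ = map-++ _

    relabelLC-· : (k : Carrier) (x : LC A) → relabelLC f (k · x) ≡ k · relabelLC f x
    relabelLC-· k [] = refl
    relabelLC-· k ((a , u) ∷ x) = cong ((k * a , relabel f u) ∷_) (relabelLC-· k x)

    relabelLC-⊖ : (x y : LC A) → relabelLC f (x ⊖ y) ≡ relabelLC f x ⊖ relabelLC f y
    relabelLC-⊖ x y = trans (relabelLC-++ x (-1# · y)) (cong (relabelLC f x ++_) (relabelLC-· -1# y))

    relabelLC-∘ : (x y : LC A) (i : ℕ) →
      relabelLC f (x ∘⟨ i ⟩ y) ≡ relabelLC f x ∘⟨ i ⟩ relabelLC f y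
    relabelLC-∘ [] y i = refl
    relabelLC-∘ (p ∷ x) y i =
      trans (relabelLC-++ (p ∘ₜ⟨ i ⟩ y) (x ∘⟨ i ⟩ y)) (cong₂ _++_ (relabelLC-∘ₜ y) (relabelLC-∘ x y i))
      where
      relabelLC-∘ₜ : ∀ y →
        relabelLC f (p ∘ₜ⟨ i ⟩ y) ≡ (proj₁ p , relabel f (proj₂ p)) ∘ₜ⟨ i ⟩ relabelLC f y
      relabelLC-∘ₜ [] = refl
      relabelLC-∘ₜ ((b , u) ∷ y) =
        cong₂ _∷_ (cong (proj₁ p * b ,_) (relabel-graft f (proj₂ p) i u)) (relabelLC-∘ₜ y)

  relabelLC-id : {A : Set} (x : LC A) → relabelLC id x ≡ x
  relabelLC-id [] = refl
  relabelLC-id ((k , u) ∷ x) = cong₂ _∷_ (cong (k ,_) (relabel-id u)) (relabelLC-id x)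

  relabelLC-compose : {A B C : Set} (g : B → C) (f : A → B) (x : LC A) →
    relabelLC (g ∘ f) x ≡ relabelLC g (relabelLC f x)
  relabelLC-compose g f [] = refl
  relabelLC-compose g f ((k , u) ∷ x) =
    cong₂ _∷_ (cong (k ,_) (relabel-∘ g f u)) (relabelLC-compose g f x)

  module _ {n : ℕ} where

    singleton-cong : ∀ {k k′} (t : Tree (Fin n)) → k ≈ k′ → [ (k , t) ] ≈LC [ (k′ , t) ]
    singleton-cong {k} {k′} t k≈k′ = ≋⇒≈LC {x = [ (k , t) ]} {[ (k′ , t) ]} ((k≈k′ , refl) ∷ [])

    node≈composite : ∀ a (l r : Tree (Fin n)) →
      [ (1# , node a l r) ] ≈LC ((genLC a ∘⟨ 1 ⟩ [ (1# , r) ]) ∘⟨ 0 ⟩ [ (1# , l) ])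
    node≈composite a l r = singleton-cong (node a l r) (≈-sym 1*1*1≈1)

    ⊖-telescope : (x y z : LC (Fin n)) → ((x ⊖ y) ++ (y ⊖ z)) ≈LC (x ⊖ z)
    ⊖-telescope x y z t = begin
      coeff ((x ⊖ y) ++ (y ⊖ z)) t                   ≈⟨ coeff-++ (x ⊖ y) _ t ⟩
      coeff (x ⊖ y) t +K coeff (y ⊖ z) t             ≈⟨ +-cong (coeff-⊖ x y t) (coeff-⊖ y z t) ⟩
      (a +K -1# * b) +K (b +K -1# * d)               ≈⟨ regroup -1# a b d ⟩
      (a +K -1# * d) +K (b +K -1# * b)               ≈⟨ +-cong ≈-refl (x-x≈0 b) ⟩
      (a +K -1# * d) +K 0#                           ≈⟨ +-identityʳ _ ⟩
      a +K -1# * d                                   ≈⟨ ≈-sym (coeff-⊖ x z t) ⟩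
      coeff (x ⊖ z) t                                ∎
      where
      a b d : Carrier
      a = coeff x t
      b = coeff y t
      d = coeff z t
      regroup : ∀ m a b d → (a +K m * b) +K (b +K m * d) ≈ (a +K m * d) +K (b +K m * b)
      regroup = solve 4 (λ m a b d → (a :+ m :* b) :+ (b :+ m :* d) := (a :+ m :* d) :+ (b :+ m :* b))
                        ≈-refl

    ⊖-++ : (x x′ y y′ : LC (Fin n)) → ((x ⊖ x′) ++ (y ⊖ y′)) ≈LC ((x ++ y) ⊖ (x′ ++ y′))
    ⊖-++ x x′ y y′ t = begin
      coeff ((x ⊖ x′) ++ (y ⊖ y′)) t               ≈⟨ coeff-++ (x ⊖ x′) _ t ⟩
      coeff (x ⊖ x′) t +K coeff (y ⊖ y′) t         ≈⟨ +-cong (coeff-⊖ x x′ t) (coeff-⊖ y y′ t) ⟩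
      (a +K -1# * a′) +K (b +K -1# * b′)           ≈⟨ interchange _ _ _ _ ⟩
      (a +K b) +K (-1# * a′ +K -1# * b′)           ≈⟨ +-cong ≈-refl (≈-sym (distribˡ _ _ _)) ⟩
      (a +K b) +K -1# * (a′ +K b′)
        ≈⟨ ≈-sym (+-cong (coeff-++ x y t) (*-cong ≈-refl (coeff-++ x′ y′ t))) ⟩
      coeff (x ++ y) t +K -1# * coeff (x′ ++ y′) t ≈⟨ ≈-sym (coeff-⊖ (x ++ y) _ t) ⟩
      coeff ((x ++ y) ⊖ (x′ ++ y′)) t              ∎
      where
      a a′ b b′ : Carrier
      a = coeff x t
      a′ = coeff x′ t
      b = coeff y t
      b′ = coeff y′ t

    ·-⊖ : (k : Carrier) (x x′ : LC (Fin n)) → (k · (x ⊖ x′)) ≈LC ((k · x) ⊖ (k · x′))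
    ·-⊖ k x x′ = ≋⇒≈LC (subst (_≋ ((k · x) ⊖ (k · x′))) (sym (·-++ k x (-1# · x′)))
                                (Pointwise.++⁺ ≋-refl (·-·-comm k -1# x′)))

    ∘-⊖ˡ : (x x′ y : LC (Fin n)) (i : ℕ) →
      ((x ⊖ x′) ∘⟨ i ⟩ y) ≈LC ((x ∘⟨ i ⟩ y) ⊖ (x′ ∘⟨ i ⟩ y))
    ∘-⊖ˡ x x′ y i = ≋⇒≈LC (subst (_≋ ((x ∘⟨ i ⟩ y) ⊖ (x′ ∘⟨ i ⟩ y)))
                                  (sym (∘-++ˡ x (-1# · x′) y i))
                                  (Pointwise.++⁺ ≋-refl (∘-·ˡ -1# x′ y i)))

    ∘-⊖ʳ : (y x x′ : LC (Fin n)) (i : ℕ) →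
      (y ∘⟨ i ⟩ (x ⊖ x′)) ≈LC ((y ∘⟨ i ⟩ x) ⊖ (y ∘⟨ i ⟩ x′))
    ∘-⊖ʳ y x x′ i t = begin
      coeff (y ∘⟨ i ⟩ (x ⊖ x′)) t
        ≈⟨ coeff-∘-++ʳ y x (-1# · x′) i t ⟩
      coeff (y ∘⟨ i ⟩ x) t +K coeff (y ∘⟨ i ⟩ (-1# · x′)) t
        ≈⟨ +-cong ≈-refl (≋⇒≈LC (∘-·ʳ -1# y x′ i) t) ⟩
      coeff (y ∘⟨ i ⟩ x) t +K coeff (-1# · (y ∘⟨ i ⟩ x′)) t
        ≈⟨ ≈-sym (coeff-++ (y ∘⟨ i ⟩ x) _ t) ⟩
      coeff ((y ∘⟨ i ⟩ x) ⊖ (y ∘⟨ i ⟩ x′)) t ∎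

module QuotientOperads {c ℓ} (K : CommutativeRing c ℓ) where
  open CommutativeRing K using (Carrier; 0#; 1#; *-identityʳ; zeroˡ)
    renaming (refl to ≈-refl; sym to ≈-sym; trans to ≈-trans)
  open Construction K
  open LinearCombinations K

  Ideal⇒Homog : (Q : FinPoset) {n : ℕ} {z : LC (Elt Q)} → Ideal Q n z → Homog n z
  Ideal⇒Homog Q (rel₁ a b p)  = refl ∷ refl ∷ []
  Ideal⇒Homog Q (rel₂ a b p)  = refl ∷ refl ∷ []
  Ideal⇒Homog Q nil           = []
  Ideal⇒Homog Q (add I J)     = ++⁺ (Ideal⇒Homog Q I) (Ideal⇒Homog Q J)
  Ideal⇒Homog Q (scale k I)   = homog-· k (Ideal⇒Homog Q I)
  Ideal⇒Homog Q (resp _ h _)  = h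
  Ideal⇒Homog Q (compL I h i) = homog-∘ (Ideal⇒Homog Q I) h i
  Ideal⇒Homog Q (compR h i I) = homog-∘ h (Ideal⇒Homog Q I) i

  module Congruence (Q : FinPoset) where

    -- A record rather than Ideal Q n (x ⊖ y) itself, so that x and y can be inferred.
    record _≃[_]_ (x : LC (Elt Q)) (n : ℕ) (y : LC (Elt Q)) : Set (c ⊔ ℓ) where
      constructor ⟦_⟧
      field difference : Ideal Q n (x ⊖ y)

    open _≃[_]_ public

    ≃-homog : ∀ {n x y} → x ≃[ n ] y → Homog n x × Homog n y
    ≃-homog {x = x} ⟦ I ⟧ = homog-⊖⁻ x (Ideal⇒Homog Q I)

    Ideal⇒≃ : ∀ {n z x y} → z ≈LC (x ⊖ y) → Homog n x → Homog n y → Ideal Q n z → x ≃[ n ] y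
    Ideal⇒≃ z≈x⊖y hx hy I = ⟦ resp z≈x⊖y (homog-⊖ hx hy) I ⟧

    ≈LC⇒≃ : ∀ {n x y} → Homog n x → Homog n y → x ≈LC y → x ≃[ n ] y
    ≈LC⇒≃ {x = x} {y} hx hy x≈y = Ideal⇒≃ (⊖-null x y x≈y) hx hy nil

    ≃-refl : ∀ {n x} → Homog n x → x ≃[ n ] x
    ≃-refl hx = ≈LC⇒≃ hx hx (λ _ → ≈-refl)

    ≡⇒≃ : ∀ {n x y} → x ≡ y → Homog n y → x ≃[ n ] y
    ≡⇒≃ refl = ≃-refl

    ≃-trans : ∀ {n x y z} → x ≃[ n ] y → y ≃[ n ] z → x ≃[ n ] z
    ≃-trans {x = x} {y} {z} x≃y@(⟦ I ⟧) y≃z@(⟦ J ⟧) =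
      Ideal⇒≃ (⊖-telescope x y z) (proj₁ (≃-homog x≃y)) (proj₂ (≃-homog y≃z)) (add I J)

    ≃-++ : ∀ {n x x′ y y′} → x ≃[ n ] x′ → y ≃[ n ] y′ → (x ++ y) ≃[ n ] (x′ ++ y′)
    ≃-++ {x = x} {x′} {y} {y′} x≃x′@(⟦ I ⟧) y≃y′@(⟦ J ⟧) with ≃-homog x≃x′ | ≃-homog y≃y′
    ... | hx , hx′ | hy , hy′ = Ideal⇒≃ (⊖-++ x x′ y y′) (++⁺ hx hy) (++⁺ hx′ hy′) (add I J)

    ≃-· : ∀ {n x x′} (k : Carrier) → x ≃[ n ] x′ → (k · x) ≃[ n ] (k · x′)
    ≃-· {x = x} {x′} k x≃x′@(⟦ I ⟧) with ≃-homog x≃x′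
    ... | hx , hx′ = Ideal⇒≃ (·-⊖ k x x′) (homog-· k hx) (homog-· k hx′) (scale k I)

    ≃-∘ˡ : ∀ {m k x x′ y} → x ≃[ m ] x′ → Homog k y → (i : Fin m) →
      (x ∘⟨ toℕ i ⟩ y) ≃[ pred m + k ] (x′ ∘⟨ toℕ i ⟩ y)
    ≃-∘ˡ {x = x} {x′} {y} x≃x′@(⟦ I ⟧) hy i with ≃-homog x≃x′
    ... | hx , hx′ =
      Ideal⇒≃ (∘-⊖ˡ x x′ y (toℕ i)) (homog-∘ hx hy i) (homog-∘ hx′ hy i) (compL I hy i)

    ≃-∘ʳ : ∀ {m k x y y′} → Homog m x → (i : Fin m) → y ≃[ k ] y′ →
      (x ∘⟨ toℕ i ⟩ y) ≃[ pred m + k ] (x ∘⟨ toℕ i ⟩ y′)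
    ≃-∘ʳ {x = x} {y} {y′} hx i y≃y′@(⟦ J ⟧) with ≃-homog y≃y′
    ... | hy , hy′ =
      Ideal⇒≃ (∘-⊖ʳ x y y′ (toℕ i)) (homog-∘ hx hy i) (homog-∘ hx hy′ i) (compR hx i J)

    ≃-∘ : ∀ {m k x x′ y y′} → x ≃[ m ] x′ → y ≃[ k ] y′ → (i : Fin m) →
      (x ∘⟨ toℕ i ⟩ y) ≃[ pred m + k ] (x′ ∘⟨ toℕ i ⟩ y′)
    ≃-∘ x≃x′ y≃y′ i =
      ≃-trans (≃-∘ˡ x≃x′ (proj₁ (≃-homog y≃y′)) i) (≃-∘ʳ (proj₂ (≃-homog x≃x′)) i y≃y′)

  Ideal-relabel : {Q₁ Q₂ : FinPoset} (φ : PosetMorphism Q₁ Q₂) {n : ℕ} {z : LC (Elt Q₁)} →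
    Ideal Q₁ n z → Ideal Q₂ n (relabelLC (fun φ) z)
  Ideal-relabel φ (rel₁ a b (inj₁ a≼b)) = rel₁ (fun φ a) (fun φ b) (inj₁ (mono φ a≼b))
  Ideal-relabel φ (rel₁ a b (inj₂ b≼a)) = rel₁ (fun φ a) (fun φ b) (inj₂ (mono φ b≼a))
  Ideal-relabel φ (rel₂ a b (inj₁ a≼b)) = rel₂ (fun φ a) (fun φ b) (inj₁ (mono φ a≼b))
  Ideal-relabel φ (rel₂ a b (inj₂ b≼a)) = rel₂ (fun φ a) (fun φ b) (inj₂ (mono φ b≼a))
  Ideal-relabel φ nil = nil
  Ideal-relabel {Q₂ = Q₂} φ (add {x = x} {y} I J) =
    subst (Ideal Q₂ _) (sym (relabelLC-++ (fun φ) x y)) (add (Ideal-relabel φ I) (Ideal-relabel φ J))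
  Ideal-relabel {Q₂ = Q₂} φ (scale {x = x} k I) =
    subst (Ideal Q₂ _) (sym (relabelLC-· (fun φ) k x)) (scale k (Ideal-relabel φ I))
  Ideal-relabel φ (resp {x = x} {y} x≈y h I) =
    resp (relabelLC-cong (fun φ) x y x≈y) (homog-relabelLC (fun φ) h) (Ideal-relabel φ I)
  Ideal-relabel {Q₂ = Q₂} φ (compL {x = x} {y} I h i) =
    subst (Ideal Q₂ _) (sym (relabelLC-∘ (fun φ) x y (toℕ i)))
      (compL (Ideal-relabel φ I) (homog-relabelLC (fun φ) h) i)
  Ideal-relabel {Q₂ = Q₂} φ (compR {x = x} {y} h i I) =
    subst (Ideal Q₂ _) (sym (relabelLC-∘ (fun φ) y x (toℕ i)))
      (compR (homog-relabelLC (fun φ) h) i (Ideal-relabel φ I))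

  module _ {Q₁ Q₂ : FinPoset} (φ : PosetMorphism Q₁ Q₂) where
    open Congruence Q₂
    private
      module C₁ = Congruence Q₁
      f : Elt Q₁ → Elt Q₂
      f = fun φ
      As : LC (Elt Q₁) → LC (Elt Q₂)
      As = As₁ φ
      homog-As : ∀ {n x} → Homog n x → Homog n (As x)
      homog-As = homog-relabelLC f

    As-isOperadMorphism : IsOperadMorphism Q₁ Q₂ As
    As-isOperadMorphism = record
      { homog    = homog-As
      ; wellDef  = λ {_} {x} {y} _ _ I → subst (Ideal Q₂ _) (relabelLC-⊖ f x y) (Ideal-relabel φ I)
      ; additive = λ {_} {x} {y} hx hy →
          difference (≡⇒≃ (relabelLC-++ f x y) (++⁺ (homog-As hx) (homog-As hy)))
      ; scalar   = λ {_} {x} k hx → difference (≡⇒≃ (relabelLC-· f k x) (homog-· k (homog-As hx)))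
      ; unit     = difference (≃-refl (refl ∷ []))
      ; comp     = λ {_} {_} {x} {y} hx hy i →
          difference (≡⇒≃ (relabelLC-∘ f x y (toℕ i)) (homog-∘ (homog-As hx) (homog-As hy) i))
      }

    As-genLC : (x : Elt Q₁) → As (genLC x) ≃[ 2 ] genLC (f x)
    As-genLC x = ≃-refl (refl ∷ [])

    module _ (F : LC (Elt Q₁) → LC (Elt Q₂)) (F-hom : IsOperadMorphism Q₁ Q₂ F)
             (F-gen : (x : Elt Q₁) → F (genLC x) ≃[ 2 ] genLC (f x)) where
      open IsOperadMorphism F-hom

      F-resp-≈LC : ∀ {n x y} → Homog n x → Homog n y → x ≈LC y → F x ≃[ n ] F y
      F-resp-≈LC hx hy x≈y = ⟦ wellDef hx hy (C₁.difference (C₁.≈LC⇒≃ hx hy x≈y)) ⟧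

      F-tree : (t : Tree (Elt Q₁)) → F [ (1# , t) ] ≃[ arity t ] [ (1# , relabel f t) ]
      F-tree leaf = ⟦ unit ⟧
      F-tree (node a l r) =
        subst (F [ (1# , node a l r) ] ≃[_] [ (1# , relabel f (node a l r)) ])
              (ℕₚ.+-comm (arity r) (arity l))
              (≃-trans decompose
              (≃-trans ⟦ comp (refl ∷ []) (refl ∷ []) fzero ⟧
              (≃-trans (≃-∘ F-⋆a∘r (F-tree l) fzero)
                       recompose)))
        where
        ⋆a∘r : LC (Elt Q₁)
        ⋆a∘r = genLC a ∘⟨ 1 ⟩ [ (1# , r) ]

        l+r : arity l + arity r ≡ arity r + arity l
        l+r = ℕₚ.+-comm (arity l) (arity r)

        fl+fr : arity (relabel f l) + arity (relabel f r) ≡ arity r + arity l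
        fl+fr = trans (cong₂ _+_ (arity-relabel f l) (arity-relabel f r)) l+r

        decompose : F [ (1# , node a l r) ] ≃[ arity r + arity l ] F (⋆a∘r ∘⟨ 0 ⟩ [ (1# , l) ])
        decompose = F-resp-≈LC (l+r ∷ []) (l+r ∷ []) (node≈composite a l r)

        F-⋆a∘r : F ⋆a∘r ≃[ suc (arity r) ] (genLC (f a) ∘⟨ 1 ⟩ [ (1# , relabel f r) ])
        F-⋆a∘r = ≃-trans ⟦ comp (refl ∷ []) (refl ∷ []) (fsuc fzero) ⟧
                         (≃-∘ (F-gen a) (F-tree r) (fsuc fzero))

        recompose : ((genLC (f a) ∘⟨ 1 ⟩ [ (1# , relabel f r) ]) ∘⟨ 0 ⟩ [ (1# , relabel f l) ])
                      ≃[ arity r + arity l ] [ (1# , relabel f (node a l r)) ]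
        recompose = ≈LC⇒≃ (fl+fr ∷ []) (fl+fr ∷ [])
                          (≈-sym ∘ node≈composite (f a) (relabel f l) (relabel f r))

      F-term : (k : Carrier) (t : Tree (Elt Q₁)) → F [ (k , t) ] ≃[ arity t ] [ (k , relabel f t) ]
      F-term k t =
        ≃-trans (F-resp-≈LC (refl ∷ []) (refl ∷ []) (singleton-cong t (≈-sym (*-identityʳ k))))
        (≃-trans ⟦ scalar k (refl ∷ []) ⟧
        (≃-trans (≃-· k (F-tree t))
                 (≈LC⇒≃ (ft ∷ []) (ft ∷ []) (singleton-cong (relabel f t) (*-identityʳ k)))))
        where
        ft : arity (relabel f t) ≡ arity t
        ft = arity-relabel f t

      F≃As : (n : ℕ) (y : LC (Elt Q₁)) → Homog n y → F y ≃[ n ] As y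
      F≃As n [] [] = ≃-trans ⟦ scalar 0# [] ⟧ (≈LC⇒≃ (homog-· 0# (homog [])) [] 0·F[]≈0)
        where
        0·F[]≈0 : (0# · F []) ≈LC []
        0·F[]≈0 t = ≈-trans (coeff-· 0# (F []) t) (zeroˡ _)
      F≃As n ((k , t) ∷ y) (refl ∷ hy) =
        ≃-trans ⟦ additive (refl ∷ []) hy ⟧ (≃-++ (F-term k t) (F≃As n y hy))

  As-id : (Q : FinPoset) (n : ℕ) (y : LC (Elt Q)) → Homog n y →
    Congruence._≃[_]_ Q (As₁ (idMorphism Q) y) n y
  As-id Q n y h = Congruence.≡⇒≃ Q (relabelLC-id y) h

  As-compose : {Q₁ Q₂ Q₃ : FinPoset} (φ : PosetMorphism Q₁ Q₂) (ψ : PosetMorphism Q₂ Q₃)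
    (n : ℕ) (y : LC (Elt Q₁)) → Homog n y →
    Congruence._≃[_]_ Q₃ (As₁ (ψ ∘P φ) y) n (As₁ ψ (As₁ φ y))
  As-compose {Q₃ = Q₃} φ ψ n y h =
    Congruence.≡⇒≃ Q₃ (relabelLC-compose (fun ψ) (fun φ) y)
                      (homog-relabelLC (fun ψ) (homog-relabelLC (fun φ) h))

theorem2p3 : {c ℓ : Level} (K : CommutativeRing c ℓ) → IsField K → CharZero K →
    let open Construction K in
    ((Q₁ Q₂ : FinPoset) (φ : PosetMorphism Q₁ Q₂) →
      IsOperadMorphism Q₁ Q₂ (As₁ φ)
      × ((x : Elt Q₁) → _~⟨_⟩_ Q₂ (As₁ φ (genLC x)) 2 (genLC (fun φ x)))
      × ((F : LC (Elt Q₁) → LC (Elt Q₂)) → IsOperadMorphism Q₁ Q₂ F →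
          ((x : Elt Q₁) → _~⟨_⟩_ Q₂ (F (genLC x)) 2 (genLC (fun φ x))) →
          (n : ℕ) (y : LC (Elt Q₁)) → Homog n y → _~⟨_⟩_ Q₂ (F y) n (As₁ φ y)))
    × ((Q : FinPoset) (n : ℕ) (y : LC (Elt Q)) → Homog n y →
         _~⟨_⟩_ Q (As₁ (idMorphism Q) y) n y)
    × ((Q₁ Q₂ Q₃ : FinPoset) (φ : PosetMorphism Q₁ Q₂) (ψ : PosetMorphism Q₂ Q₃)
         (n : ℕ) (y : LC (Elt Q₁)) → Homog n y →
         _~⟨_⟩_ Q₃ (As₁ (ψ ∘P φ) y) n (As₁ ψ (As₁ φ y)))
theorem2p3 K _ _ =
    (λ Q₁ Q₂ φ →
        As-isOperadMorphism φ
      , (λ x → difference (As-genLC φ x))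
      , (λ F F-hom F-gen n y h → difference (F≃As φ F F-hom (λ x → ⟦ F-gen x ⟧) n y h)))
  , (λ Q n y h → difference (As-id Q n y h))
  , (λ Q₁ Q₂ Q₃ φ ψ n y h → difference (As-compose φ ψ n y h))
  where open QuotientOperads K
        open Congruence using (difference; ⟦_⟧)
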